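{- The kernel $M$ of a path-independent stream automaton $A_n$ over $[1,n]$ is a sub-module of $\mathbb{Z}^n$.
   Context: A stream over $[1,n]$ is a finite sequence of records $\pm e_i$ ($e_i$ standard basis vectors of $\mathbb{Z}^n$); $\mathrm{freq}\,\sigma$ is the sum of its records. A stream automaton $A_n$ is a deterministic Turing machine with finite control, a work tape and a one-way input tape holding the stream; its configurations (state, head position, work-tape contents) evolve by a transition $a\oplus v$ on record $v$, extended left-associatively to streams; $o$ is the initial configuration. $A_n$ is path independent if for every configuration $s$ and stream $\sigma$, $s\oplus\sigma$ depends only on $s$ and $\mathrm{freq}\,\sigma$. For such $A_n$, define $x+a = a\oplus\sigma$ for any stream $\sigma$ with $\mathrm{freq}\,\sigma=x$ ($x\in\mathbb{Z}^n$, $a$ a configuration). The kernel is $M=\{x\in\mathbb{Z}^n : x+o = 0+o\}$. -}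

module Defs where

open import Data.Nat using (ℕ; zero; suc)
open import Data.Integer using (ℤ; +_; -[1+_]; _+_; _*_; -_; 0ℤ; 1ℤ)
open import Data.Fin using (Fin; zero; suc; _≟_)
open import Data.Vec using (Vec; []; _∷_; zipWith; replicate; tabulate)
import Data.Vec as Vec
open import Data.List using (List; []; _∷_; _++_; foldl; foldr)
import Data.List as List
open import Data.Bool using (Bool; true; false; if_then_else_)
open import Data.Product using (_×_; _,_)
open import Relation.Nullary.Decidable using (⌊_⌋)
open import Relation.Binary.PropositionalEquality using (_≡_)

-- A record of a stream over [1,n]: a sign and an index, standing for ±e_i.
data Sign : Set where
  plus minus : Sign

Record : ℕ → Set
Record n = Sign × Fin n

Stream : ℕ → Set
Stream n = List (Record n)

e : ∀ {n} → Fin n → Vec ℤ n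
e i = tabulate (λ j → if ⌊ i ≟ j ⌋ then 1ℤ else 0ℤ)

vec : ∀ {n} → Record n → Vec ℤ n
vec (plus  , i) = e i
vec (minus , i) = Vec.map -_ (e i)

0ᵛ : ∀ {n} → Vec ℤ n
0ᵛ = replicate _ 0ℤ

_+ᵛ_ : ∀ {n} → Vec ℤ n → Vec ℤ n → Vec ℤ n
_+ᵛ_ = zipWith _+_

_·ᵛ_ : ∀ {n} → ℤ → Vec ℤ n → Vec ℤ n
k ·ᵛ x = Vec.map (k *_) x

freq : ∀ {n} → Stream n → Vec ℤ n
freq = foldr (λ r acc → vec r +ᵛ acc) 0ᵛ

-- A stream automaton over [1,n], abstracted to its configuration space,
-- initial configuration o, and transition a ⊕ v on a record v.
record StreamAutomaton (n : ℕ) : Set₁ where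
  field
    Config : Set
    o      : Config
    _⊕_    : Config → Record n → Config

  _⊕*_ : Config → Stream n → Config
  a ⊕* σ = foldl _⊕_ a σ

PathIndependent : ∀ {n} → StreamAutomaton n → Set
PathIndependent {n} A =
  ∀ (s : Config) (σ τ : Stream n) → freq σ ≡ freq τ → s ⊕* σ ≡ s ⊕* τ
  where open StreamAutomaton A

copies : ∀ {n} → ℕ → Record n → Stream n
copies zero    r = []
copies (suc k) r = r ∷ copies k r

streamOf : ∀ {n} → Vec ℤ n → Stream n
streamOf [] = []
streamOf (c ∷ v) = here c ++ List.map shift (streamOf v)
  where
  here : ℤ → Stream _
  here (+ k)      = copies k (plus , zero)
  here -[1+ k ]   = copies (suc k) (minus , zero)
  shift : Record _ → Record _
  shift (s , i) = (s , suc i)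

-- x + a := a ⊕ σ for any σ with freq σ = x (well defined for path
-- independent automata; we use the canonical σ = streamOf x)
act : ∀ {n} (A : StreamAutomaton n) → Vec ℤ n → StreamAutomaton.Config A → StreamAutomaton.Config A
act A x a = a ⊕* streamOf x
  where open StreamAutomaton A

Kernel : ∀ {n} → StreamAutomaton n → Vec ℤ n → Set
Kernel A x = act A x (StreamAutomaton.o A) ≡ act A 0ᵛ (StreamAutomaton.o A)

record IsSubmodule {n : ℕ} (P : Vec ℤ n → Set) : Set where
  field
    zero-mem : P 0ᵛ
    +-closed : ∀ x y → P x → P y → P (x +ᵛ y)
    ·-closed : ∀ (k : ℤ) x → P x → P (k ·ᵛ x)

{-# OPTIONS --safe #-}
module Submission where

open import Defs
open import Data.Nat using (ℕ; zero; suc)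
open import Data.Integer using (ℤ; +_; -[1+_]; _+_; _*_; -_; 0ℤ; 1ℤ; -1ℤ)
import Data.Integer.Properties as ℤ
open import Data.Fin using (Fin; zero; suc; _≟_)
open import Data.Fin.Properties using (suc-injective)
open import Data.Vec using (Vec; []; _∷_; replicate)
import Data.Vec as Vec
open import Data.Vec.Properties
  using (map-cong; map-id; map-const; map-replicate; tabulate-allFin; tabulate-cong)
open import Data.Vec.Relation.Binary.Pointwise.Inductive
  using (Pointwise-≡⇒≡; zipWith-assoc; zipWith-identityˡ; zipWith-identityʳ)
open import Data.List using ([]; _∷_; _++_)
import Data.List as List
open import Data.List.Properties using (foldl-++)
open import Data.Product using (_,_)
open import Data.Bool using (if_then_else_)
open import Relation.Nullary.Decidable using (⌊⌋-map′)
open import Relation.Binary.PropositionalEquality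
open ≡-Reasoning

-- Path independence makes x + a an action of the group ℤ^n on configurations
-- (x + (y + a) = (x + y) + a, witnessed by concatenating canonical streams),
-- and the kernel is the stabiliser of o. A stabiliser is an additive subgroup,
-- and an additive subgroup of ℤ^n is closed under integer scalars.

+ᵛ-assoc : ∀ {n} (x y z : Vec ℤ n) → (x +ᵛ y) +ᵛ z ≡ x +ᵛ (y +ᵛ z)
+ᵛ-assoc x y z = Pointwise-≡⇒≡ (zipWith-assoc ℤ.+-assoc x y z)

+ᵛ-identityˡ : ∀ {n} (x : Vec ℤ n) → 0ᵛ +ᵛ x ≡ x
+ᵛ-identityˡ x = Pointwise-≡⇒≡ (zipWith-identityˡ ℤ.+-identityˡ x)

+ᵛ-identityʳ : ∀ {n} (x : Vec ℤ n) → x +ᵛ 0ᵛ ≡ x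
+ᵛ-identityʳ x = Pointwise-≡⇒≡ (zipWith-identityʳ ℤ.+-identityʳ x)

·ᵛ-distribʳ : ∀ {n} (j k : ℤ) (x : Vec ℤ n) → (j + k) ·ᵛ x ≡ (j ·ᵛ x) +ᵛ (k ·ᵛ x)
·ᵛ-distribʳ j k []      = refl
·ᵛ-distribʳ j k (a ∷ x) = cong₂ _∷_ (ℤ.*-distribʳ-+ a j k) (·ᵛ-distribʳ j k x)

·ᵛ-identityˡ : ∀ {n} (x : Vec ℤ n) → 1ℤ ·ᵛ x ≡ x
·ᵛ-identityˡ x = trans (map-cong ℤ.*-identityˡ x) (map-id x)

·ᵛ-suc : ∀ {n} (k : ℤ) (x : Vec ℤ n) → (1ℤ + k) ·ᵛ x ≡ x +ᵛ (k ·ᵛ x)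
·ᵛ-suc k x = trans (·ᵛ-distribʳ 1ℤ k x) (cong (_+ᵛ (k ·ᵛ x)) (·ᵛ-identityˡ x))

·ᵛ-zeroˡ : ∀ {n} (x : Vec ℤ n) → 0ℤ ·ᵛ x ≡ 0ᵛ
·ᵛ-zeroˡ x = map-const x 0ℤ

·ᵛ-zeroʳ : ∀ n (k : ℤ) → k ·ᵛ 0ᵛ {n} ≡ 0ᵛ
·ᵛ-zeroʳ n k = trans (map-replicate (k *_) 0ℤ n) (cong (replicate n) (ℤ.*-zeroʳ k))

+ᵛ-inverseʳ : ∀ {n} (x : Vec ℤ n) → x +ᵛ (-1ℤ ·ᵛ x) ≡ 0ᵛ
+ᵛ-inverseʳ x = begin
  x +ᵛ (-1ℤ ·ᵛ x)         ≡⟨ cong (_+ᵛ (-1ℤ ·ᵛ x)) (sym (·ᵛ-identityˡ x)) ⟩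
  (1ℤ ·ᵛ x) +ᵛ (-1ℤ ·ᵛ x) ≡⟨ sym (·ᵛ-distribʳ 1ℤ -1ℤ x) ⟩
  0ℤ ·ᵛ x                 ≡⟨ ·ᵛ-zeroˡ x ⟩
  0ᵛ                      ∎

subgroup⇒isSubmodule : ∀ {n} {P : Vec ℤ n → Set} →
  P 0ᵛ → (∀ x y → P x → P y → P (x +ᵛ y)) → (∀ x → P x → P (-1ℤ ·ᵛ x)) →
  IsSubmodule P
subgroup⇒isSubmodule {P = P} P0 P+ P- = record
  { zero-mem = P0 ; +-closed = P+ ; ·-closed = P· }
  where
  P· : ∀ k x → P x → P (k ·ᵛ x)
  P· (+ zero)       x Px = subst P (sym (·ᵛ-zeroˡ x)) P0
  P· (+ suc m)      x Px = subst P (sym (·ᵛ-suc (+ m) x)) (P+ x _ Px (P· (+ m) x Px))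
  P· -[1+ zero ]    x Px = P- x Px
  P· -[1+ suc m ]   x Px = subst P (sym (·ᵛ-distribʳ -1ℤ -[1+ m ] x))
                                   (P+ _ _ (P- x Px) (P· -[1+ m ] x Px))

-- The stabiliser is phrased against 0ᵛ ▷ c, not c, so that it is literally Kernel.
stabiliser-isSubmodule : ∀ {n} {C : Set} (_▷_ : Vec ℤ n → C → C) →
  (∀ c → 0ᵛ ▷ c ≡ c) → (∀ x y c → (x +ᵛ y) ▷ c ≡ y ▷ (x ▷ c)) →
  ∀ c → IsSubmodule (λ x → x ▷ c ≡ 0ᵛ ▷ c)
stabiliser-isSubmodule _▷_ ▷-identity ▷-+ᵛ c =
  subgroup⇒isSubmodule refl closed-+ᵛ closed-neg
  where
  fixes : ∀ {x} → x ▷ c ≡ 0ᵛ ▷ c → x ▷ c ≡ c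
  fixes p = trans p (▷-identity c)

  closed-+ᵛ : ∀ x y → x ▷ c ≡ 0ᵛ ▷ c → y ▷ c ≡ 0ᵛ ▷ c → (x +ᵛ y) ▷ c ≡ 0ᵛ ▷ c
  closed-+ᵛ x y p q = begin
    (x +ᵛ y) ▷ c  ≡⟨ ▷-+ᵛ x y c ⟩
    y ▷ (x ▷ c)   ≡⟨ cong (y ▷_) (fixes p) ⟩
    y ▷ c         ≡⟨ q ⟩
    0ᵛ ▷ c        ∎

  closed-neg : ∀ x → x ▷ c ≡ 0ᵛ ▷ c → (-1ℤ ·ᵛ x) ▷ c ≡ 0ᵛ ▷ c
  closed-neg x p = begin
    (-1ℤ ·ᵛ x) ▷ c          ≡⟨ cong ((-1ℤ ·ᵛ x) ▷_) (sym (fixes p)) ⟩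
    (-1ℤ ·ᵛ x) ▷ (x ▷ c)    ≡⟨ sym (▷-+ᵛ x (-1ℤ ·ᵛ x) c) ⟩
    (x +ᵛ (-1ℤ ·ᵛ x)) ▷ c   ≡⟨ cong (_▷ c) (+ᵛ-inverseʳ x) ⟩
    0ᵛ ▷ c                  ∎

freq-++ : ∀ {n} (σ τ : Stream n) → freq (σ ++ τ) ≡ freq σ +ᵛ freq τ
freq-++ []      τ = sym (+ᵛ-identityˡ (freq τ))
freq-++ (r ∷ σ) τ =
  trans (cong (vec r +ᵛ_) (freq-++ σ τ)) (sym (+ᵛ-assoc (vec r) (freq σ) (freq τ)))

freq-copies : ∀ {n} k (r : Record n) → freq (copies k r) ≡ (+ k) ·ᵛ vec r
freq-copies zero    r = sym (·ᵛ-zeroˡ (vec r))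
freq-copies (suc k) r =
  trans (cong (vec r +ᵛ_) (freq-copies k r)) (sym (·ᵛ-suc (+ k) (vec r)))

-- Agrees definitionally with the local shift used by streamOf.
shift : ∀ {n} → Record n → Record (suc n)
shift (s , i) = (s , suc i)

e-zero : ∀ n → e {suc n} zero ≡ 1ℤ ∷ 0ᵛ
e-zero n = cong (1ℤ ∷_) (trans (tabulate-allFin _) (map-const (Vec.allFin n) 0ℤ))

-- Not refl: ⌊_⌋ is stuck on the neutral decision i ≟ j.
e-suc : ∀ {n} (i : Fin n) → e (suc i) ≡ 0ℤ ∷ e i
e-suc i = cong (0ℤ ∷_) (tabulate-cong λ j →
  cong (λ b → if b then 1ℤ else 0ℤ) (⌊⌋-map′ (cong suc) suc-injective (i ≟ j)))

vec-shift : ∀ {n} (r : Record n) → vec (shift r) ≡ 0ℤ ∷ vec r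
vec-shift (plus  , i) = e-suc i
vec-shift (minus , i) = cong (Vec.map -_) (e-suc i)

freq-map-shift : ∀ {n} (σ : Stream n) → freq (List.map shift σ) ≡ 0ℤ ∷ freq σ
freq-map-shift []      = refl
freq-map-shift (r ∷ σ) = cong₂ _+ᵛ_ (vec-shift r) (freq-map-shift σ)

freq-copies-plus : ∀ {n} k → freq (copies {suc n} k (plus , zero)) ≡ (+ k) ∷ 0ᵛ
freq-copies-plus {n} k = begin
  freq (copies k (plus , zero))  ≡⟨ freq-copies k (plus , zero) ⟩
  (+ k) ·ᵛ e zero                ≡⟨ cong ((+ k) ·ᵛ_) (e-zero n) ⟩
  ((+ k) * 1ℤ) ∷ ((+ k) ·ᵛ 0ᵛ)   ≡⟨ cong₂ _∷_ (ℤ.*-identityʳ (+ k)) (·ᵛ-zeroʳ n (+ k)) ⟩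
  (+ k) ∷ 0ᵛ                     ∎

freq-copies-minus : ∀ {n} k → freq (copies {suc n} (suc k) (minus , zero)) ≡ -[1+ k ] ∷ 0ᵛ
freq-copies-minus {n} k = begin
  freq (copies (suc k) (minus , zero))      ≡⟨ freq-copies (suc k) (minus , zero) ⟩
  (+ suc k) ·ᵛ Vec.map -_ (e zero)          ≡⟨ cong (λ v → (+ suc k) ·ᵛ Vec.map -_ v) (e-zero n) ⟩
  (+ suc k) ·ᵛ (-1ℤ ∷ Vec.map -_ 0ᵛ)        ≡⟨ cong (λ v → (+ suc k) ·ᵛ (-1ℤ ∷ v)) (map-replicate -_ 0ℤ n) ⟩
  ((+ suc k) * -1ℤ) ∷ ((+ suc k) ·ᵛ 0ᵛ)     ≡⟨ cong₂ _∷_ (trans (ℤ.*-comm (+ suc k) -1ℤ) (ℤ.-1*i≡-i (+ suc k)))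
                                                         (·ᵛ-zeroʳ n (+ suc k)) ⟩
  -[1+ k ] ∷ 0ᵛ                             ∎

freq-++-map-shift : ∀ {n} {c : ℤ} {x : Vec ℤ n} (σ : Stream (suc n)) (τ : Stream n) →
  freq σ ≡ c ∷ 0ᵛ → freq τ ≡ x → freq (σ ++ List.map shift τ) ≡ c ∷ x
freq-++-map-shift {c = c} {x} σ τ σ≡c τ≡x = begin
  freq (σ ++ List.map shift τ)             ≡⟨ freq-++ σ (List.map shift τ) ⟩
  freq σ +ᵛ freq (List.map shift τ)        ≡⟨ cong₂ _+ᵛ_ σ≡c (trans (freq-map-shift τ) (cong (0ℤ ∷_) τ≡x)) ⟩
  (c + 0ℤ) ∷ (0ᵛ +ᵛ x)                     ≡⟨ cong₂ _∷_ (ℤ.+-identityʳ c) (+ᵛ-identityˡ x) ⟩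
  c ∷ x                                    ∎

freq-streamOf : ∀ {n} (x : Vec ℤ n) → freq (streamOf x) ≡ x
freq-streamOf []             = refl
freq-streamOf (+ k ∷ x)      = freq-++-map-shift (copies k (plus , zero)) (streamOf x)
                                                 (freq-copies-plus k) (freq-streamOf x)
freq-streamOf (-[1+ k ] ∷ x) = freq-++-map-shift (copies (suc k) (minus , zero)) (streamOf x)
                                                 (freq-copies-minus k) (freq-streamOf x)

module _ {n} (A : StreamAutomaton n) (path-independent : PathIndependent A) where
  open StreamAutomaton A

  ⊕*≡act : ∀ s σ {x} → freq σ ≡ x → s ⊕* σ ≡ act A x s
  ⊕*≡act s σ refl = path-independent s σ (streamOf (freq σ)) (sym (freq-streamOf (freq σ)))

  act-0ᵛ : ∀ s → act A 0ᵛ s ≡ s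
  act-0ᵛ s = sym (⊕*≡act s [] refl)

  act-+ᵛ : ∀ x y s → act A (x +ᵛ y) s ≡ act A y (act A x s)
  act-+ᵛ x y s = begin
    act A (x +ᵛ y) s                ≡⟨ sym (⊕*≡act s (streamOf x ++ streamOf y) freq≡x+y) ⟩
    s ⊕* (streamOf x ++ streamOf y) ≡⟨ foldl-++ _⊕_ s (streamOf x) (streamOf y) ⟩
    act A y (act A x s)             ∎
    where
    freq≡x+y : freq (streamOf x ++ streamOf y) ≡ x +ᵛ y
    freq≡x+y = trans (freq-++ (streamOf x) (streamOf y))
                     (cong₂ _+ᵛ_ (freq-streamOf x) (freq-streamOf y))

lemma2 : (n : ℕ) (A : StreamAutomaton n) → PathIndependent A → IsSubmodule (Kernel A)
lemma2 n A path-independent =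
  stabiliser-isSubmodule (act A) (act-0ᵛ A path-independent) (act-+ᵛ A path-independent)
                         (StreamAutomaton.o A)
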